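{- Let $T$ be a caterpillar with $n$ nodes, let $p=(u_1,\ldots,u_{m})$ be a longest path in $T$, and root $T$ at $u_1$. For $1\le i\le m$ let $L_i$ be the set of children of $u_i$ other than $u_{i+1}$ (for $i=m$, all children of $u_m$, of which there are none), let $\gamma_i=\lceil \lg(1+|L_i|)\rceil$, let $k_i=\max_{1\le j\le m}(\gamma_j-|i-j|)$ and $l(u_i)=2^{k_i}$. Assign integer ids as follows, for $i=1,2,\ldots,m$ in order: $id(u_1)=0$, and for $i\ge2$, $id(u_i)$ is the smallest integer $x\ge id(u_{i-1})+l(u_{i-1})$ whose $k_i$ least significant binary digits are all $0$; then, writing $L_i=\{v_1,\ldots,v_{|L_i|}\}$, set $id(v_j)=id(u_i)+j$. Let $N$ be the maximum id assigned. Then $N\le 12n$.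
   Context: A caterpillar is a tree whose non-leaf nodes induce a path. For $x>0$, $\lg x=\max(1,\log_2 x)$. -}

module Defs where

open import Data.Nat using (ℕ; zero; suc; _+_; _*_; _∸_; _^_; _≤_; _⊔_; ∣_-_∣; _/_)
open import Data.Nat.Properties using (m^n≢0)
open import Data.Nat.Logarithm using (⌈log₂_⌉)
open import Data.Fin using (Fin; zero; suc; toℕ; fromℕ; _≟_)
open import Data.Bool using (Bool; true; false; _∧_; not; if_then_else_)
open import Data.Maybe using (Maybe; just; nothing)
open import Data.Product using (Σ; ∃; ∃-syntax; _×_; _,_)
open import Data.Sum using (_⊎_)
open import Data.Empty using (⊥)
open import Relation.Nullary using (¬_)
open import Relation.Nullary.Decidable using (⌊_⌋)
open import Relation.Binary.PropositionalEquality using (_≡_; _≢_)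
open import Function using (_∘_; _⇔_)

Graph : ℕ → Set
Graph n = Fin n → Fin n → Bool

countᵇ : ∀ {n} → (Fin n → Bool) → ℕ
countᵇ {zero}  p = 0
countᵇ {suc n} p = (if p zero then 1 else 0) + countᵇ (p ∘ suc)

degree : ∀ {n} → Graph n → Fin n → ℕ
degree G v = countᵇ (G v)

IsWalk : ∀ {n m} → Graph n → (Fin m → Fin n) → Set
IsWalk {m = m} G w = ∀ (i j : Fin m) → toℕ j ≡ suc (toℕ i) → G (w i) (w j) ≡ true

IsPath : ∀ {n m} → Graph n → (Fin m → Fin n) → Set
IsPath G w = (∀ i j → w i ≡ w j → i ≡ j) × IsWalk G w

Connected : ∀ {n} → Graph n → Set
Connected {n} G = ∀ (x y : Fin n) →
  ∃[ m ] Σ (Fin (suc m) → Fin n) λ w → IsWalk G w × w zero ≡ x × w (fromℕ m) ≡ y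

Acyclic : ∀ {n} → Graph n → Set
Acyclic {n} G = ∀ (m : ℕ) (w : Fin (3 + m) → Fin n) →
  IsPath G w → G (w zero) (w (fromℕ (2 + m))) ≡ true → ⊥

IsTree : ∀ {n} → Graph n → Set
IsTree G = (∀ x y → G x y ≡ G y x) × (∀ x → G x x ≡ false) × Connected G × Acyclic G

IsLeaf : ∀ {n} → Graph n → Fin n → Set
IsLeaf G v = degree G v ≡ 1

-- caterpillar: a tree whose non-leaf vertices induce a path, i.e. they can be
-- listed without repetition as s 0, ..., s (k-1) so that two of them are adjacent
-- exactly when their positions are consecutive.
IsCaterpillar : ∀ {n} → Graph n → Set
IsCaterpillar {n} G = IsTree G ×
  ∃[ k ] Σ (Fin k → Fin n) λ s →
    (∀ i j → s i ≡ s j → i ≡ j) ×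
    (∀ x → (¬ IsLeaf G x) ⇔ (∃[ i ] s i ≡ x)) ×
    (∀ i j → (G (s i) (s j) ≡ true) ⇔ (toℕ j ≡ suc (toℕ i) ⊎ toℕ i ≡ suc (toℕ j)))

-- a longest path (u_1, ..., u_m) is represented by u : Fin m → Fin n (u_{i+1} = u i)
IsLongestPath : ∀ {n m} → Graph n → (Fin m → Fin n) → Set
IsLongestPath {n} {m} G u = IsPath G u × (∀ m′ (w : Fin m′ → Fin n) → IsPath G w → m′ ≤ m)

-- The sets L_i (0-based index i, i.e. L_{i+1} in the paper) for T rooted at u_1

lookupℕ : ∀ {m} {A : Set} → (Fin m → A) → ℕ → Maybe A
lookupℕ {zero}  f i       = nothing
lookupℕ {suc m} f zero    = just (f zero)
lookupℕ {suc m} f (suc i) = lookupℕ (f ∘ suc) i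

notIs : ∀ {n} → Fin n → Maybe (Fin n) → Bool
notIs v nothing  = true
notIs v (just w) = not ⌊ v ≟ w ⌋

parentOnPath : ∀ {n m} → (Fin m → Fin n) → ℕ → Maybe (Fin n)
parentOnPath u zero    = nothing
parentOnPath u (suc i) = lookupℕ u i

-- |L_i| = number of children of u_i (neighbours other than its parent) other than u_{i+1};
-- 0 for indices outside the path
sizeL : ∀ {n m} → Graph n → (Fin m → Fin n) → ℕ → ℕ
sizeL G u i with lookupℕ u i
... | nothing = 0
... | just ui  = countᵇ (λ v → G ui v ∧ notIs v (parentOnPath u i) ∧ notIs v (lookupℕ u (suc i)))

maxUpTo : ℕ → (ℕ → ℕ) → ℕ
maxUpTo zero    f = 0
maxUpTo (suc m) f = maxUpTo m f ⊔ f m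

-- γ_i = ⌈ lg (1 + |L_i|) ⌉ with lg x = max(1, log₂ x), i.e. max(1, ⌈log₂(1+|L_i|)⌉)
gammaC : (ℕ → ℕ) → ℕ → ℕ
gammaC c j = 1 ⊔ ⌈log₂ (1 + c j) ⌉

-- k_i = max_j (γ_j - |i - j|); the term j = i is ≥ 1, so truncated subtraction
-- gives the same maximum as integer subtraction
kC : ℕ → (ℕ → ℕ) → ℕ → ℕ
kC m c i = maxUpTo m (λ j → gammaC c j ∸ ∣ i - j ∣)

-- smallest x ≥ a whose k least significant binary digits are 0, i.e. ⌈a/2^k⌉·2^k
alignUp : ℕ → ℕ → ℕ
alignUp a k = ((a + (2 ^ k ∸ 1)) / 2 ^ k) {{m^n≢0 2 k}} * 2 ^ k

idPath : ℕ → (ℕ → ℕ) → ℕ → ℕ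
idPath m c zero    = 0
idPath m c (suc i) = alignUp (idPath m c i + 2 ^ kC m c i) (kC m c (suc i))

-- N = maximum id assigned: the children in L_i get ids id(u_i)+1, ..., id(u_i)+|L_i|
maxId : ℕ → (ℕ → ℕ) → ℕ
maxId m c = maxUpTo m (λ i → idPath m c i + c i)

-- Rounding up to a multiple of 2^{kᵢ₊₁} gives id(uᵢ₊₁) < id(uᵢ) + 2^{kᵢ} + 2^{kᵢ₊₁}, and
-- |Lᵢ| < 2^{γᵢ} ≤ 2^{kᵢ}, so every id, and hence N, is at most 2 ∑ᵢ 2^{kᵢ}. Bounding 2^{max}
-- by a sum and exchanging the two sums gives ∑ᵢ 2^{kᵢ} ≤ 3 ∑ⱼ 2^{γⱼ}, since ∑ᵢ 2^{γⱼ - |i-j|}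
-- is geometric on both sides of j; and 2^{γⱼ} ≤ 2 (1 + |Lⱼ|). Finally, in a forest the sets
-- {uⱼ} ∪ Lⱼ are pairwise disjoint (a shared vertex would close a cycle with a segment of the
-- path), so m + ∑ⱼ |Lⱼ| ≤ n.
module Submission where

open import Data.Bool using (Bool; true; false; _∧_; _∨_; not)
open import Data.Empty using (⊥; ⊥-elim)
open import Data.Fin as Fin using (Fin; zero; suc; toℕ; fromℕ; fromℕ<)
open import Data.Fin.Properties using (toℕ-injective; toℕ-fromℕ<; toℕ-fromℕ; toℕ<n; fromℕ<-toℕ; any?)
open import Data.Maybe using (Maybe; just; nothing)
open import Data.Nat
open import Data.Nat.DivMod using (m/n*n≤m)
open import Data.Nat.Induction using (<-rec)
open import Data.Nat.Logarithm
open import Data.Nat.Logarithm.Core using (⌈log2⌉-acc-irrelevant)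
open import Data.Nat.Properties
open import Data.Nat.Tactic.RingSolver using (solve-∀)
open import Data.Product using (∃; _×_; _,_; proj₁; proj₂)
open import Data.Sum using (_⊎_; inj₁; inj₂)
open import Data.Vec.Functional using (_∷_)
open import Function using (_∘_; case_of_)
open import Relation.Binary.Definitions using (tri<; tri≈; tri>)
open import Relation.Binary.PropositionalEquality
open import Relation.Nullary using (Dec; yes; no)
open import Relation.Nullary.Decidable using (⌊_⌋; dec-true; isYes≗does)

open import Defs

private variable
  n : ℕ

-- ⌈log₂_⌉ unfolds by one step here; only the accessibility proofs differ.
⌈log₂[2+n]⌉≡1+⌈log₂⌈[2+n]/2⌉⌉ : ∀ n → ⌈log₂ (2 + n) ⌉ ≡ 1 + ⌈log₂ ⌈ 2 + n /2⌉ ⌉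
⌈log₂[2+n]⌉≡1+⌈log₂⌈[2+n]/2⌉⌉ n = cong suc (⌈log2⌉-acc-irrelevant ⌈ 2 + n /2⌉)

n≤2*⌈n/2⌉ : ∀ n → n ≤ 2 * ⌈ n /2⌉
n≤2*⌈n/2⌉ n = begin
  n                        ≡⟨ sym (⌊n/2⌋+⌈n/2⌉≡n n) ⟩
  ⌊ n /2⌋ + ⌈ n /2⌉        ≤⟨ +-monoˡ-≤ ⌈ n /2⌉ (⌊n/2⌋≤⌈n/2⌉ n) ⟩
  ⌈ n /2⌉ + ⌈ n /2⌉        ≡⟨ cong (⌈ n /2⌉ +_) (sym (+-identityʳ ⌈ n /2⌉)) ⟩
  2 * ⌈ n /2⌉              ∎
  where open ≤-Reasoning

2*⌊n/2⌋≤n : ∀ n → 2 * ⌊ n /2⌋ ≤ n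
2*⌊n/2⌋≤n n = begin
  2 * ⌊ n /2⌋              ≡⟨ cong (⌊ n /2⌋ +_) (+-identityʳ ⌊ n /2⌋) ⟩
  ⌊ n /2⌋ + ⌊ n /2⌋        ≤⟨ +-monoʳ-≤ ⌊ n /2⌋ (⌊n/2⌋≤⌈n/2⌉ n) ⟩
  ⌊ n /2⌋ + ⌈ n /2⌉        ≡⟨ ⌊n/2⌋+⌈n/2⌉≡n n ⟩
  n                        ∎
  where open ≤-Reasoning

n≤2^⌈log₂n⌉ : ∀ n → n ≤ 2 ^ ⌈log₂ n ⌉
n≤2^⌈log₂n⌉ = <-rec _ step
  where
  open ≤-Reasoning
  step : ∀ n → (∀ {m} → m < n → m ≤ 2 ^ ⌈log₂ m ⌉) → n ≤ 2 ^ ⌈log₂ n ⌉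
  step zero          _   = z≤n
  step (suc zero)    _   = s≤s z≤n
  step (suc (suc n)) rec = begin
    2 + n                        ≤⟨ n≤2*⌈n/2⌉ (2 + n) ⟩
    2 * ⌈ 2 + n /2⌉              ≤⟨ *-monoʳ-≤ 2 (rec (⌈n/2⌉<n n)) ⟩
    2 * 2 ^ ⌈log₂ ⌈ 2 + n /2⌉ ⌉  ≡⟨ cong (2 ^_) (sym (⌈log₂[2+n]⌉≡1+⌈log₂⌈[2+n]/2⌉⌉ n)) ⟩
    2 ^ ⌈log₂ (2 + n) ⌉          ∎

-- ⌈ 3 + n /2⌉ is 2 + ⌊ n /2⌋ by definition, so the recursion lands in the same shape.
2^⌈log₂[2+n]⌉≤2*[1+n] : ∀ n → 2 ^ ⌈log₂ (2 + n) ⌉ ≤ 2 * (1 + n)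
2^⌈log₂[2+n]⌉≤2*[1+n] = <-rec _ step
  where
  open ≤-Reasoning
  step : ∀ n → (∀ {m} → m < n → 2 ^ ⌈log₂ (2 + m) ⌉ ≤ 2 * (1 + m)) → 2 ^ ⌈log₂ (2 + n) ⌉ ≤ 2 * (1 + n)
  step zero    _   = ≤-refl
  step (suc n) rec = begin
    2 ^ ⌈log₂ (3 + n) ⌉                ≡⟨ cong (2 ^_) (⌈log₂[2+n]⌉≡1+⌈log₂⌈[2+n]/2⌉⌉ (suc n)) ⟩
    2 * 2 ^ ⌈log₂ (2 + ⌊ n /2⌋) ⌉      ≤⟨ *-monoʳ-≤ 2 (rec (s≤s (⌊n/2⌋≤n n))) ⟩
    2 * (2 * (1 + ⌊ n /2⌋))            ≤⟨ *-monoʳ-≤ 2 (≤-reflexive (*-distribˡ-+ 2 1 ⌊ n /2⌋)) ⟩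
    2 * (2 + 2 * ⌊ n /2⌋)              ≤⟨ *-monoʳ-≤ 2 (+-monoʳ-≤ 2 (2*⌊n/2⌋≤n n)) ⟩
    2 * (2 + n)                        ∎

sumUpTo : ℕ → (ℕ → ℕ) → ℕ
sumUpTo zero    f = 0
sumUpTo (suc m) f = sumUpTo m f + f m

sumUpTo-mono-≤ : ∀ m {f g : ℕ → ℕ} → (∀ i → i < m → f i ≤ g i) → sumUpTo m f ≤ sumUpTo m g
sumUpTo-mono-≤ zero    f≤g = z≤n
sumUpTo-mono-≤ (suc m) f≤g =
  +-mono-≤ (sumUpTo-mono-≤ m (λ i i<m → f≤g i (m<n⇒m<1+n i<m))) (f≤g m ≤-refl)

sumUpTo-monoˡ-≤ : ∀ {m p} f → m ≤ p → sumUpTo m f ≤ sumUpTo p f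
sumUpTo-monoˡ-≤ f m≤p = go (≤⇒≤′ m≤p)
  where
  go : ∀ {m p} → m ≤′ p → sumUpTo m f ≤ sumUpTo p f
  go ≤′-refl        = ≤-refl
  go (≤′-step m≤′p) = ≤-trans (go m≤′p) (m≤m+n _ _)

sumUpTo-distrib-+ : ∀ m (f g : ℕ → ℕ) → sumUpTo m (λ i → f i + g i) ≡ sumUpTo m f + sumUpTo m g
sumUpTo-distrib-+ zero    f g = refl
sumUpTo-distrib-+ (suc m) f g = begin
  sumUpTo m (λ i → f i + g i) + (f m + g m) ≡⟨ cong (_+ (f m + g m)) (sumUpTo-distrib-+ m f g) ⟩
  sumUpTo m f + sumUpTo m g + (f m + g m)   ≡⟨ +-interchange (sumUpTo m f) _ _ _ ⟩
  sumUpTo m f + f m + (sumUpTo m g + g m)   ∎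
  where
  open ≡-Reasoning
  +-interchange : ∀ a b c d → a + b + (c + d) ≡ a + c + (b + d)
  +-interchange = solve-∀

sumUpTo-const : ∀ m k → sumUpTo m (λ _ → k) ≡ m * k
sumUpTo-const zero    k = refl
sumUpTo-const (suc m) k = trans (cong (_+ k) (sumUpTo-const m k)) (+-comm (m * k) k)

sumUpTo-*ˡ : ∀ m k (f : ℕ → ℕ) → sumUpTo m (λ i → k * f i) ≡ k * sumUpTo m f
sumUpTo-*ˡ zero    k f = sym (*-zeroʳ k)
sumUpTo-*ˡ (suc m) k f =
  trans (cong (_+ k * f m) (sumUpTo-*ˡ m k f)) (sym (*-distribˡ-+ k (sumUpTo m f) (f m)))

sumUpTo-comm : ∀ m p (F : ℕ → ℕ → ℕ) →
  sumUpTo m (λ i → sumUpTo p (F i)) ≡ sumUpTo p (λ j → sumUpTo m (λ i → F i j))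
sumUpTo-comm zero    p F = sym (trans (sumUpTo-const p 0) (*-zeroʳ p))
sumUpTo-comm (suc m) p F = trans (cong (_+ sumUpTo p (F m)) (sumUpTo-comm m p F))
  (sym (sumUpTo-distrib-+ p (λ j → sumUpTo m (λ i → F i j)) (F m)))

sumUpTo-suc : ∀ m (f : ℕ → ℕ) → sumUpTo (suc m) f ≡ f 0 + sumUpTo m (f ∘ suc)
sumUpTo-suc zero    f = +-comm 0 (f 0)
sumUpTo-suc (suc m) f =
  trans (cong (_+ f (suc m)) (sumUpTo-suc m f)) (+-assoc (f 0) (sumUpTo m (f ∘ suc)) (f (suc m)))

sumUpTo-∣-∣≤ : ∀ (h : ℕ → ℕ) m j →
  sumUpTo m (λ i → h ∣ i - j ∣) ≤ sumUpTo (suc j) h + sumUpTo m (h ∘ suc)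
sumUpTo-∣-∣≤ h zero    j       = z≤n
sumUpTo-∣-∣≤ h (suc m) zero    = begin
  sumUpTo (suc m) (λ i → h ∣ i - 0 ∣) ≡⟨ sumUpTo-suc m (λ i → h ∣ i - 0 ∣) ⟩
  h 0 + sumUpTo m (h ∘ suc)             ≤⟨ +-monoʳ-≤ (h 0) (m≤m+n _ _) ⟩
  h 0 + sumUpTo (suc m) (h ∘ suc)       ∎
  where open ≤-Reasoning
sumUpTo-∣-∣≤ h (suc m) (suc j) = begin
  sumUpTo (suc m) (λ i → h ∣ i - suc j ∣)            ≡⟨ sumUpTo-suc m (λ i → h ∣ i - suc j ∣) ⟩
  h (suc j) + sumUpTo m (λ i → h ∣ i - j ∣)           ≤⟨ +-monoʳ-≤ (h (suc j)) (sumUpTo-∣-∣≤ h m j) ⟩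
  h (suc j) + (sumUpTo (suc j) h + sumUpTo m (h ∘ suc)) ≡⟨ sym (+-assoc (h (suc j)) _ _) ⟩
  h (suc j) + sumUpTo (suc j) h + sumUpTo m (h ∘ suc)   ≡⟨ cong (_+ sumUpTo m (h ∘ suc)) (+-comm (h (suc j)) _) ⟩
  sumUpTo (suc (suc j)) h + sumUpTo m (h ∘ suc)         ≤⟨ +-monoʳ-≤ (sumUpTo (suc (suc j)) h) (m≤m+n _ _) ⟩
  sumUpTo (suc (suc j)) h + sumUpTo (suc m) (h ∘ suc)   ∎
  where open ≤-Reasoning

geometric-< : ∀ γ N → sumUpTo N (λ d → 2 ^ (γ ∸ d) ∸ 1) < 2 ^ suc γ
geometric-< zero N = begin-strict
  sumUpTo N (λ d → 2 ^ (0 ∸ d) ∸ 1) ≤⟨ sumUpTo-mono-≤ N (λ d _ → ≤-reflexive (cong (λ e → 2 ^ e ∸ 1) (0∸n≡0 d))) ⟩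
  sumUpTo N (λ _ → 0)               ≡⟨ trans (sumUpTo-const N 0) (*-zeroʳ N) ⟩
  0                                 <⟨ s≤s z≤n ⟩
  2                                 ∎
  where open ≤-Reasoning
geometric-< (suc γ) zero = m^n>0 2 (2 + γ)
geometric-< (suc γ) (suc N) = begin-strict
  sumUpTo (suc N) (λ d → 2 ^ (suc γ ∸ d) ∸ 1)        ≡⟨ sumUpTo-suc N (λ d → 2 ^ (suc γ ∸ d) ∸ 1) ⟩
  (2 ^ suc γ ∸ 1) + sumUpTo N (λ d → 2 ^ (γ ∸ d) ∸ 1) <⟨ +-mono-≤-< (m∸n≤m (2 ^ suc γ) 1) (geometric-< γ N) ⟩
  2 ^ suc γ + 2 ^ suc γ                               ≡⟨ cong (2 ^ suc γ +_) (sym (+-identityʳ (2 ^ suc γ))) ⟩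
  2 ^ suc (suc γ)                                     ∎
  where open ≤-Reasoning

geometric-tail-≤ : ∀ γ N → sumUpTo N (λ d → 2 ^ (γ ∸ suc d) ∸ 1) ≤ 2 ^ γ
geometric-tail-≤ zero    N = ≤-trans (≤-reflexive (trans (sumUpTo-const N 0) (*-zeroʳ N))) z≤n
geometric-tail-≤ (suc γ) N = <⇒≤ (geometric-< γ N)

sumUpTo-2^[γ∸∣i-j∣]∸1< : ∀ γ m j → sumUpTo m (λ i → 2 ^ (γ ∸ ∣ i - j ∣) ∸ 1) < 3 * 2 ^ γ
sumUpTo-2^[γ∸∣i-j∣]∸1< γ m j = begin-strict
  sumUpTo m (λ i → h ∣ i - j ∣)              ≤⟨ sumUpTo-∣-∣≤ h m j ⟩
  sumUpTo (suc j) h + sumUpTo m (h ∘ suc)    <⟨ +-mono-<-≤ (geometric-< γ (suc j)) (geometric-tail-≤ γ m) ⟩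
  2 ^ suc γ + 2 ^ γ                          ≡⟨ 2*x+x≡3*x (2 ^ γ) ⟩
  3 * 2 ^ γ                                  ∎
  where
  open ≤-Reasoning
  h : ℕ → ℕ
  h d = 2 ^ (γ ∸ d) ∸ 1
  2*x+x≡3*x : ∀ x → 2 * x + x ≡ 3 * x
  2*x+x≡3*x = solve-∀

≤-maxUpTo : ∀ m (f : ℕ → ℕ) {i} → i < m → f i ≤ maxUpTo m f
≤-maxUpTo (suc m) f {i} i<1+m with i ≟ m
... | yes refl = m≤n⊔m (maxUpTo m f) (f m)
... | no  i≢m  = ≤-trans (≤-maxUpTo m f (≤∧≢⇒< (≤-pred i<1+m) i≢m)) (m≤m⊔n (maxUpTo m f) (f m))

maxUpTo-lub : ∀ m (f : ℕ → ℕ) {b} → (∀ i → i < m → f i ≤ b) → maxUpTo m f ≤ b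
maxUpTo-lub zero    f f≤b = z≤n
maxUpTo-lub (suc m) f f≤b = ⊔-lub (maxUpTo-lub m f (λ i i<m → f≤b i (m<n⇒m<1+n i<m))) (f≤b m ≤-refl)

-- The ∸ 1 makes terms with exponent 0 vanish; otherwise summing this bound over i would
-- pick up a 1 for every pair (i, j) with ∣ i - j ∣ ≥ γⱼ.
^-maxUpTo-≤ : ∀ b m (f : ℕ → ℕ) → b ^ maxUpTo m f ≤ 1 + sumUpTo m (λ j → b ^ f j ∸ 1)
^-maxUpTo-≤ b zero    f = ≤-refl
^-maxUpTo-≤ b (suc m) f with ≤-total (f m) (maxUpTo m f)
... | inj₁ fm≤max rewrite m≥n⇒m⊔n≡m fm≤max = ≤-trans (^-maxUpTo-≤ b m f) (m≤m+n _ _)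
... | inj₂ max≤fm rewrite m≤n⇒m⊔n≡n max≤fm = begin
  b ^ f m                                          ≤⟨ m≤n+m∸n (b ^ f m) 1 ⟩
  1 + (b ^ f m ∸ 1)                                ≤⟨ +-monoˡ-≤ (b ^ f m ∸ 1) (m≤m+n 1 _) ⟩
  1 + sumUpTo m (λ j → b ^ f j ∸ 1) + (b ^ f m ∸ 1) ∎
  where open ≤-Reasoning

1+c≤2^γ : ∀ c j → 1 + c j ≤ 2 ^ gammaC c j
1+c≤2^γ c j = ≤-trans (n≤2^⌈log₂n⌉ (1 + c j)) (^-monoʳ-≤ 2 (m≤n⊔m 1 ⌈log₂ (1 + c j) ⌉))

2^γ≤2*[1+c] : ∀ c j → 2 ^ gammaC c j ≤ 2 * (1 + c j)
2^γ≤2*[1+c] c j with c j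
... | zero  = ≤-refl
... | suc x = ≤-trans (2^⌈log₂[2+n]⌉≤2*[1+n] x) (*-monoʳ-≤ 2 (n≤1+n (1 + x)))

alignUp-≤ : ∀ a k → alignUp a k ≤ a + 2 ^ k
alignUp-≤ a k = ≤-trans (m/n*n≤m (a + (2 ^ k ∸ 1)) (2 ^ k) {{m^n≢0 2 k}}) (+-monoʳ-≤ a (m∸n≤m (2 ^ k) 1))

module _ (m : ℕ) (c : ℕ → ℕ) where

  γ≤k : ∀ {i} → i < m → gammaC c i ≤ kC m c i
  γ≤k {i} i<m = subst (_≤ kC m c i) (cong (gammaC c i ∸_) (∣n-n∣≡0 i))
    (≤-maxUpTo m (λ j → gammaC c j ∸ ∣ i - j ∣) i<m)

  idPath+2^k≤ : ∀ i → idPath m c i + 2 ^ kC m c i ≤ 2 * sumUpTo (suc i) (λ j → 2 ^ kC m c j)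
  idPath+2^k≤ zero    = m≤m+n (2 ^ kC m c 0) _
  idPath+2^k≤ (suc i) = begin
    alignUp (idPath m c i + K i) (kC m c (suc i)) + K (suc i)
      ≤⟨ +-monoˡ-≤ (K (suc i)) (alignUp-≤ (idPath m c i + K i) (kC m c (suc i))) ⟩
    idPath m c i + K i + K (suc i) + K (suc i)
      ≤⟨ +-monoˡ-≤ (K (suc i)) (+-monoˡ-≤ (K (suc i)) (idPath+2^k≤ i)) ⟩
    2 * sumUpTo (suc i) K + K (suc i) + K (suc i)
      ≡⟨ 2*a+b+b≡2*[a+b] (sumUpTo (suc i) K) (K (suc i)) ⟩
    2 * sumUpTo (suc (suc i)) K ∎
    where
    open ≤-Reasoning
    K : ℕ → ℕ
    K j = 2 ^ kC m c j
    2*a+b+b≡2*[a+b] : ∀ a b → 2 * a + b + b ≡ 2 * (a + b)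
    2*a+b+b≡2*[a+b] = solve-∀

  maxId≤2*∑2^k : maxId m c ≤ 2 * sumUpTo m (λ j → 2 ^ kC m c j)
  maxId≤2*∑2^k = maxUpTo-lub m (λ i → idPath m c i + c i) λ i i<m → begin
    idPath m c i + c i                    ≤⟨ +-monoʳ-≤ (idPath m c i) (≤-trans (n≤1+n (c i))
                                               (≤-trans (1+c≤2^γ c i) (^-monoʳ-≤ 2 (γ≤k i<m)))) ⟩
    idPath m c i + 2 ^ kC m c i           ≤⟨ idPath+2^k≤ i ⟩
    2 * sumUpTo (suc i) (λ j → 2 ^ kC m c j) ≤⟨ *-monoʳ-≤ 2 (sumUpTo-monoˡ-≤ _ i<m) ⟩
    2 * sumUpTo m (λ j → 2 ^ kC m c j)    ∎
    where open ≤-Reasoning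

  ∑2^k≤3*∑2^γ : sumUpTo m (λ i → 2 ^ kC m c i) ≤ 3 * sumUpTo m (λ j → 2 ^ gammaC c j)
  ∑2^k≤3*∑2^γ = begin
    sumUpTo m (λ i → 2 ^ kC m c i)
      ≤⟨ sumUpTo-mono-≤ m (λ i _ → ^-maxUpTo-≤ 2 m (λ j → gammaC c j ∸ ∣ i - j ∣)) ⟩
    sumUpTo m (λ i → 1 + sumUpTo m (λ j → F i j))
      ≡⟨ sumUpTo-distrib-+ m (λ _ → 1) _ ⟩
    sumUpTo m (λ _ → 1) + sumUpTo m (λ i → sumUpTo m (λ j → F i j))
      ≡⟨ cong (sumUpTo m (λ _ → 1) +_) (sumUpTo-comm m m F) ⟩
    sumUpTo m (λ _ → 1) + sumUpTo m (λ j → sumUpTo m (λ i → F i j))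
      ≡⟨ sym (sumUpTo-distrib-+ m (λ _ → 1) _) ⟩
    sumUpTo m (λ j → 1 + sumUpTo m (λ i → F i j))
      ≤⟨ sumUpTo-mono-≤ m (λ j _ → sumUpTo-2^[γ∸∣i-j∣]∸1< (gammaC c j) m j) ⟩
    sumUpTo m (λ j → 3 * 2 ^ gammaC c j)
      ≡⟨ sumUpTo-*ˡ m 3 (λ j → 2 ^ gammaC c j) ⟩
    3 * sumUpTo m (λ j → 2 ^ gammaC c j) ∎
    where
    open ≤-Reasoning
    F : ℕ → ℕ → ℕ
    F i j = 2 ^ (gammaC c j ∸ ∣ i - j ∣) ∸ 1

  ∑2^γ≤2*[m+∑c] : sumUpTo m (λ j → 2 ^ gammaC c j) ≤ 2 * (m + sumUpTo m c)
  ∑2^γ≤2*[m+∑c] = begin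
    sumUpTo m (λ j → 2 ^ gammaC c j)   ≤⟨ sumUpTo-mono-≤ m (λ j _ → 2^γ≤2*[1+c] c j) ⟩
    sumUpTo m (λ j → 2 * (1 + c j))    ≡⟨ sumUpTo-*ˡ m 2 (λ j → 1 + c j) ⟩
    2 * sumUpTo m (λ j → 1 + c j)      ≡⟨ cong (2 *_) (sumUpTo-distrib-+ m (λ _ → 1) c) ⟩
    2 * (sumUpTo m (λ _ → 1) + sumUpTo m c) ≡⟨ cong (λ x → 2 * (x + sumUpTo m c)) (trans (sumUpTo-const m 1) (*-identityʳ m)) ⟩
    2 * (m + sumUpTo m c)              ∎
    where open ≤-Reasoning

  maxId≤12*[m+∑c] : maxId m c ≤ 12 * (m + sumUpTo m c)
  maxId≤12*[m+∑c] = begin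
    maxId m c                                  ≤⟨ maxId≤2*∑2^k ⟩
    2 * sumUpTo m (λ j → 2 ^ kC m c j)         ≤⟨ *-monoʳ-≤ 2 ∑2^k≤3*∑2^γ ⟩
    2 * (3 * sumUpTo m (λ j → 2 ^ gammaC c j)) ≤⟨ *-monoʳ-≤ 2 (*-monoʳ-≤ 3 ∑2^γ≤2*[m+∑c]) ⟩
    2 * (3 * (2 * (m + sumUpTo m c)))          ≡⟨ 2*[3*[2*x]]≡12*x (m + sumUpTo m c) ⟩
    12 * (m + sumUpTo m c)                     ∎
    where
    open ≤-Reasoning
    2*[3*[2*x]]≡12*x : ∀ x → 2 * (3 * (2 * x)) ≡ 12 * x
    2*[3*[2*x]]≡12*x = solve-∀

∧-true : ∀ {a b} → a ∧ b ≡ true → a ≡ true × b ≡ true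
∧-true {true} b≡true = refl , b≡true

∨-true : ∀ {a b} → a ∨ b ≡ true → a ≡ true ⊎ b ≡ true
∨-true {true}  _        = inj₁ refl
∨-true {false} b≡true = inj₂ b≡true

⌊⌋≡true⇐ : ∀ {A : Set} (a? : Dec A) → A → ⌊ a? ⌋ ≡ true
⌊⌋≡true⇐ a? a = trans (isYes≗does a?) (dec-true a? a)

notIs-just : ∀ {v w : Fin n} → notIs v (just w) ≡ true → v ≢ w
notIs-just {v = v} {w} v≠w v≡w = case trans (sym v≠w) (cong not (⌊⌋≡true⇐ (v Fin.≟ w) v≡w)) of λ ()

countᵇ-≤ : (p : Fin n → Bool) → countᵇ p ≤ n
countᵇ-≤ {zero}  p = z≤n
countᵇ-≤ {suc n} p with p zero
... | true  = s≤s (countᵇ-≤ (p ∘ suc))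
... | false = m≤n⇒m≤1+n (countᵇ-≤ (p ∘ suc))

countᵇ-pos : (p : Fin n → Bool) {v : Fin n} → p v ≡ true → 1 ≤ countᵇ p
countᵇ-pos p {zero}  pv rewrite pv = s≤s z≤n
countᵇ-pos p {suc v} pv = ≤-trans (countᵇ-pos (p ∘ suc) pv) (m≤n+m _ _)

countᵇ-∨ : (p q : Fin n → Bool) → (∀ v → p v ≡ true → q v ≡ true → ⊥) →
           countᵇ p + countᵇ q ≤ countᵇ (λ v → p v ∨ q v)
countᵇ-∨ {zero}  p q disjoint = z≤n
countᵇ-∨ {suc n} p q disjoint
  with p zero in p₀ | q zero in q₀ | countᵇ-∨ (p ∘ suc) (q ∘ suc) (disjoint ∘ suc)
... | true  | true  | _  = ⊥-elim (disjoint zero p₀ q₀)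
... | true  | false | ih = s≤s ih
... | false | true  | ih = ≤-trans (≤-reflexive (+-suc _ _)) (s≤s ih)
... | false | false | ih = ih

anyUpTo : ℕ → (ℕ → Fin n → Bool) → Fin n → Bool
anyUpTo zero    P v = false
anyUpTo (suc m) P v = anyUpTo m P v ∨ P m v

anyUpTo-witness : ∀ m (P : ℕ → Fin n → Bool) {v} → anyUpTo m P v ≡ true → ∃ λ i → i < m × P i v ≡ true
anyUpTo-witness (suc m) P {v} any≡true with anyUpTo m P v in any≡
... | true  = let i , i<m , Piv = anyUpTo-witness m P any≡ in i , m<n⇒m<1+n i<m , Piv
... | false = m , ≤-refl , any≡true

PairwiseDisjointUpTo : ℕ → (ℕ → Fin n → Bool) → Set
PairwiseDisjointUpTo m P = ∀ {i j v} → i < j → j < m → P i v ≡ true → P j v ≡ true → ⊥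

sumUpTo-countᵇ-≤ : ∀ m (P : ℕ → Fin n → Bool) → PairwiseDisjointUpTo m P →
                   sumUpTo m (λ i → countᵇ (P i)) ≤ n
sumUpTo-countᵇ-≤ m P disjoint = ≤-trans (≤-countᵇ-anyUpTo m disjoint) (countᵇ-≤ (anyUpTo m P))
  where
  ≤-countᵇ-anyUpTo : ∀ m → PairwiseDisjointUpTo m P → sumUpTo m (λ i → countᵇ (P i)) ≤ countᵇ (anyUpTo m P)
  ≤-countᵇ-anyUpTo zero    _        = z≤n
  ≤-countᵇ-anyUpTo (suc m) disjoint = ≤-trans
    (+-monoˡ-≤ (countᵇ (P m)) (≤-countᵇ-anyUpTo m (λ i<j j<m → disjoint i<j (m<n⇒m<1+n j<m))))
    (countᵇ-∨ (anyUpTo m P) (P m) λ v any≡true Pmv →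
      let i , i<m , Piv = anyUpTo-witness m P any≡true in disjoint i<m ≤-refl Piv Pmv)

lookupℕ-fromℕ< : ∀ {m} {A : Set} (f : Fin m → A) i .(i<m : i < m) → lookupℕ f i ≡ just (f (fromℕ< i<m))
lookupℕ-fromℕ< {suc m} f zero    _   = refl
lookupℕ-fromℕ< {suc m} f (suc i) i<m = lookupℕ-fromℕ< (f ∘ suc) i (s<s⁻¹ i<m)

module _ (G : Graph n) where

  ∷-isPath : ∀ {k} {w : Fin (suc k) → Fin n} {x} →
             IsPath G w → (∀ t → w t ≢ x) → G x (w zero) ≡ true → IsPath G (x ∷ w)
  ∷-isPath {w = w} {x} (w-injective , w-walk) x∉w x~w₀ = injective , walk
    where
    injective : ∀ s t → (x ∷ w) s ≡ (x ∷ w) t → s ≡ t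
    injective zero    zero    _ = refl
    injective zero    (suc t) e = ⊥-elim (x∉w t (sym e))
    injective (suc s) zero    e = ⊥-elim (x∉w s e)
    injective (suc s) (suc t) e = cong suc (w-injective s t e)
    walk : IsWalk G (x ∷ w)
    walk zero    (suc zero) _ = x~w₀
    walk (suc s) (suc t)    e = w-walk s t (suc-injective e)

  Acyclic⇒¬common-neighbour-of-ends : Acyclic G → ∀ {d} {w : Fin (2 + d) → Fin n} {x} →
    IsPath G w → (∀ t → w t ≢ x) → G x (w zero) ≡ true → G x (w (fromℕ (suc d))) ≡ true → ⊥
  Acyclic⇒¬common-neighbour-of-ends acyclic {d} w-path x∉w x~first x~last =
    acyclic d _ (∷-isPath w-path x∉w x~first) x~last

module _ {G : Graph n} (G-sym : ∀ x y → G x y ≡ G y x) (G-irrefl : ∀ x → G x x ≡ false)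
         (G-acyclic : Acyclic G) {m} {u : Fin m → Fin n} (u-path : IsPath G u) where

  vertex : (i : ℕ) → .(i < m) → Fin n
  vertex i i<m = u (fromℕ< i<m)

  vertex-cong : ∀ {i j} .{p : i < m} .{q : j < m} → i ≡ j → vertex i p ≡ vertex j q
  vertex-cong refl = refl

  vertex-injective : ∀ {i j} .{p : i < m} .{q : j < m} → vertex i p ≡ vertex j q → i ≡ j
  vertex-injective {p = p} {q} e =
    trans (sym (toℕ-fromℕ< p)) (trans (cong toℕ (proj₁ u-path _ _ e)) (toℕ-fromℕ< q))

  vertex-adjacent : ∀ {i j} .{p : i < m} .{q : j < m} → j ≡ suc i → G (vertex i p) (vertex j q) ≡ true
  vertex-adjacent {p = p} {q} j≡1+i =
    proj₂ u-path _ _ (trans (toℕ-fromℕ< q) (trans j≡1+i (cong suc (sym (toℕ-fromℕ< p)))))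

  segment : ∀ i d → .(i + d < m) → Fin (suc d) → Fin n
  segment i d i+d<m t = vertex (i + toℕ t) (≤-<-trans (+-monoʳ-≤ i (s≤s⁻¹ (toℕ<n t))) i+d<m)

  segment-isPath : ∀ i d .(i+d<m : i + d < m) → IsPath G (segment i d i+d<m)
  segment-isPath i d _ =
    (λ s t e → toℕ-injective (+-cancelˡ-≡ i _ _ (vertex-injective e))) ,
    (λ s t t≡1+s → vertex-adjacent (trans (cong (i +_) t≡1+s) (+-suc i (toℕ s))))

  segment-last : ∀ i d .(i+d<m : i + d < m) → segment i d i+d<m (fromℕ d) ≡ vertex (i + d) i+d<m
  segment-last i d _ = vertex-cong (cong (i +_) (toℕ-fromℕ d))

  ¬off-path-common-neighbour : ∀ {i j x} .{p : i < m} .{q : j < m} → i < j →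
    (∀ t → u t ≢ x) → G x (vertex i p) ≡ true → G x (vertex j q) ≡ true → ⊥
  ¬off-path-common-neighbour {i} {j} {x} {q = q} i<j x∉u x~uᵢ x~uⱼ with m≤n⇒∃[o]m+o≡n (<⇒≤ i<j)
  ... | zero  , refl = <-irrefl (sym (+-identityʳ i)) i<j
  ... | suc d , refl = Acyclic⇒¬common-neighbour-of-ends G G-acyclic (segment-isPath i (suc d) q) (λ _ → x∉u _)
    (subst (λ y → G x y ≡ true) (vertex-cong (sym (+-identityʳ i))) x~uᵢ)
    (subst (λ y → G x y ≡ true) (sym (segment-last i (suc d) q)) x~uⱼ)

  adjacent-vertices-consecutive-< : ∀ {i j} .{p : i < m} .{q : j < m} → i < j →
    G (vertex i p) (vertex j q) ≡ true → j ≡ suc i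
  adjacent-vertices-consecutive-< {i} {j} {p} {q} i<j uᵢ~uⱼ with m≤n⇒∃[o]m+o≡n i<j
  ... | zero  , refl = cong suc (+-identityʳ i)
  ... | suc d , refl = ⊥-elim (Acyclic⇒¬common-neighbour-of-ends G G-acyclic (segment-isPath (suc i) (suc d) q)
    (λ t uᵢ₊₁₊ₜ≡uᵢ → m≢1+m+n i (sym (vertex-injective uᵢ₊₁₊ₜ≡uᵢ)))
    (vertex-adjacent (cong suc (+-identityʳ i)))
    (subst (λ y → G (vertex i p) y ≡ true) (sym (segment-last (suc i) (suc d) q)) uᵢ~uⱼ))

  adjacent-vertices-consecutive : ∀ {i j} .{p : i < m} .{q : j < m} →
    G (vertex i p) (vertex j q) ≡ true → j ≡ suc i ⊎ i ≡ suc j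
  adjacent-vertices-consecutive {i} {j} uᵢ~uⱼ with <-cmp i j
  ... | tri≈ _ refl _ = case trans (sym uᵢ~uⱼ) (G-irrefl _) of λ ()
  ... | tri< i<j _ _  = inj₁ (adjacent-vertices-consecutive-< i<j uᵢ~uⱼ)
  ... | tri> _ _ j<i  = inj₂ (adjacent-vertices-consecutive-< j<i (trans (G-sym _ _) uᵢ~uⱼ))

  adjacentTo : Maybe (Fin n) → Fin n → Bool
  adjacentTo nothing  v = false
  adjacentTo (just w) v = G w v

  -- isVertex i and child i are the indicators of {uᵢ} and of Lᵢ; both are empty for i ≥ m.
  isVertex : ℕ → Fin n → Bool
  isVertex i v = not (notIs v (lookupℕ u i))

  child : ℕ → Fin n → Bool
  child i v = adjacentTo (lookupℕ u i) v ∧ notIs v (parentOnPath u i) ∧ notIs v (lookupℕ u (suc i))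

  vertexOrChild : ℕ → Fin n → Bool
  vertexOrChild i v = isVertex i v ∨ child i v

  sizeL≡countᵇ-child : ∀ {i} → i < m → sizeL G u i ≡ countᵇ (child i)
  sizeL≡countᵇ-child {i} i<m rewrite lookupℕ-fromℕ< u i i<m = refl

  isVertex-vertex : ∀ {i} (i<m : i < m) → isVertex i (vertex i i<m) ≡ true
  isVertex-vertex {i} i<m rewrite lookupℕ-fromℕ< u i i<m | ⌊⌋≡true⇐ (vertex i i<m Fin.≟ vertex i i<m) refl = refl

  isVertex⇒≡ : ∀ {i v} (i<m : i < m) → isVertex i v ≡ true → v ≡ vertex i i<m
  isVertex⇒≡ {i} {v} i<m isV rewrite lookupℕ-fromℕ< u i i<m with v Fin.≟ vertex i i<m
  ... | yes v≡uᵢ = v≡uᵢ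

  child⇒adjacent : ∀ {i v} (i<m : i < m) → child i v ≡ true → G (vertex i i<m) v ≡ true
  child⇒adjacent {i} i<m isChild rewrite lookupℕ-fromℕ< u i i<m = proj₁ (∧-true isChild)

  child⇒≢parent : ∀ {l v} (l<m : l < m) → child (suc l) v ≡ true → v ≢ vertex l l<m
  child⇒≢parent {l} {v} l<m isChild rewrite lookupℕ-fromℕ< u l l<m =
    notIs-just (proj₁ (∧-true (proj₂ (∧-true {adjacentTo (lookupℕ u (suc l)) v} isChild))))

  child⇒≢next : ∀ {i v} (1+i<m : suc i < m) → child i v ≡ true → v ≢ vertex (suc i) 1+i<m
  child⇒≢next {i} {v} 1+i<m isChild rewrite lookupℕ-fromℕ< u (suc i) 1+i<m =
    notIs-just (proj₂ (∧-true (proj₂ (∧-true {adjacentTo (lookupℕ u i) v} isChild))))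

  vertex-not-child : ∀ {i l} (i<m : i < m) (l<m : l < m) → child i (vertex l l<m) ≡ true → ⊥
  vertex-not-child {i} {l} i<m l<m isChild with adjacent-vertices-consecutive (child⇒adjacent i<m isChild)
  ... | inj₁ refl = child⇒≢next l<m isChild refl
  ... | inj₂ refl = child⇒≢parent l<m isChild refl

  isVertex⇒¬child : ∀ {i j v} (i<m : i < m) (j<m : j < m) → isVertex j v ≡ true → child i v ≡ true → ⊥
  isVertex⇒¬child i<m j<m isV ch = vertex-not-child i<m j<m (subst (λ w → child _ w ≡ true) (isVertex⇒≡ j<m isV) ch)

  vertexOrChild-disjoint : PairwiseDisjointUpTo m vertexOrChild
  vertexOrChild-disjoint {i} {j} {v} i<j j<m inᵢ inⱼ =
    disjoint (<-trans i<j j<m) (∨-true {isVertex i v} inᵢ) (∨-true {isVertex j v} inⱼ)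
    where
    disjoint : i < m → isVertex i v ≡ true ⊎ child i v ≡ true → isVertex j v ≡ true ⊎ child j v ≡ true → ⊥
    disjoint i<m (inj₁ isVᵢ) (inj₁ isVⱼ) =
      <-irrefl (vertex-injective (trans (sym (isVertex⇒≡ i<m isVᵢ)) (isVertex⇒≡ j<m isVⱼ))) i<j
    disjoint i<m (inj₁ isVᵢ) (inj₂ chⱼ)  = isVertex⇒¬child j<m i<m isVᵢ chⱼ
    disjoint i<m (inj₂ chᵢ)  (inj₁ isVⱼ) = isVertex⇒¬child i<m j<m isVⱼ chᵢ
    disjoint i<m (inj₂ chᵢ)  (inj₂ chⱼ) with any? (λ t → u t Fin.≟ v)
    ... | yes (t , refl) =
      vertex-not-child i<m (toℕ<n t) (subst (λ w → child i w ≡ true) (cong u (sym (fromℕ<-toℕ t (toℕ<n t)))) chᵢ)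
    ... | no v∉u = ¬off-path-common-neighbour i<j (λ t uₜ≡v → v∉u (t , uₜ≡v))
      (trans (G-sym _ _) (child⇒adjacent i<m chᵢ)) (trans (G-sym _ _) (child⇒adjacent j<m chⱼ))

  1+sizeL≤countᵇ-vertexOrChild : ∀ {i} → i < m → 1 + sizeL G u i ≤ countᵇ (vertexOrChild i)
  1+sizeL≤countᵇ-vertexOrChild {i} i<m rewrite sizeL≡countᵇ-child i<m =
    ≤-trans (+-monoˡ-≤ (countᵇ (child i)) (countᵇ-pos (isVertex i) (isVertex-vertex i<m)))
      (countᵇ-∨ (isVertex i) (child i) λ _ → isVertex⇒¬child i<m i<m)

  m+∑sizeL≤n : m + sumUpTo m (sizeL G u) ≤ n
  m+∑sizeL≤n = begin
    m + sumUpTo m (sizeL G u)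
      ≡⟨ cong (_+ sumUpTo m (sizeL G u)) (sym (trans (sumUpTo-const m 1) (*-identityʳ m))) ⟩
    sumUpTo m (λ _ → 1) + sumUpTo m (sizeL G u)   ≡⟨ sym (sumUpTo-distrib-+ m (λ _ → 1) (sizeL G u)) ⟩
    sumUpTo m (λ i → 1 + sizeL G u i)             ≤⟨ sumUpTo-mono-≤ m (λ _ → 1+sizeL≤countᵇ-vertexOrChild) ⟩
    sumUpTo m (λ i → countᵇ (vertexOrChild i))    ≤⟨ sumUpTo-countᵇ-≤ m vertexOrChild vertexOrChild-disjoint ⟩
    n                                             ∎
    where open ≤-Reasoning

lemma3 : (n : ℕ) (T : Graph n) → IsCaterpillar T →
         (m : ℕ) (u : Fin m → Fin n) → IsLongestPath T u →
         maxId m (sizeL T u) ≤ 12 * n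
lemma3 n T ((T-sym , T-irrefl , _ , T-acyclic) , _) m u (u-path , _) = begin
  maxId m (sizeL T u)               ≤⟨ maxId≤12*[m+∑c] m (sizeL T u) ⟩
  12 * (m + sumUpTo m (sizeL T u))  ≤⟨ *-monoʳ-≤ 12 (m+∑sizeL≤n T-sym T-irrefl T-acyclic u-path) ⟩
  12 * n                            ∎
  where open ≤-Reasoning
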